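{- Let $p\ge 3$ and $\tau\in\{\mu_{\rm t},\mu_{\rm o},{\rm gp}_{\rm t},{\rm gp}_{\rm o}\}$. Then $\tau(S_p^2)=p$, and there is exactly one set with property $\tau$ of cardinality $p$ in $S_p^2$.
   Context: For $p\ge 3$, $n\ge1$, the Sierpiński graph $S_p^n$ has vertex set $\{0,1,\dots,p-1\}^n$ (vertices written as words $i_1\cdots i_n$), and $i_1\cdots i_n$ is adjacent to $j_1\cdots j_n$ iff there is $h\in\{1,\dots,n\}$ with $i_t=j_t$ for all $t<h$, $i_h\ne j_h$, and $i_t=j_h$, $j_t=i_h$ for all $t>h$. For a graph $G$ and $X\subseteq V(G)$: $u,v$ are $X$-visible if some shortest $u,v$-path $P$ has $V(P)\cap X\subseteq\{u,v\}$, and $X$-positionable if every shortest $u,v$-path $P$ has $V(P)\cap X\subseteq\{u,v\}$. $X$ is a total mutual-visibility set if every two vertices of $G$ are $X$-visible; an outer mutual-visibility set if every two vertices of $X$ are $X$-visible and every $u\in X$, $v\in V(G)\setminus X$ are $X$-visible. Total and outer general position sets are defined the same way with "$X$-positionable" in place of "$X$-visible". $\mu_{\rm t},\mu_{\rm o},{\rm gp}_{\rm t},{\rm gp}_{\rm o}$ denote the respective maximum sizes, and a "set with property $\tau$" means a set of the corresponding type. -}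

module Defs where

open import Data.Nat using (ℕ; _≤_)
open import Data.Fin using (Fin; _<_)
open import Data.Vec using (Vec; lookup)
open import Data.List using (List; []; _∷_; length)
open import Data.List.Membership.Propositional using (_∈_; _∉_)
open import Data.List.Relation.Unary.Unique.Propositional using (Unique)
open import Data.Product using (Σ; ∃; _×_)
open import Data.Sum using (_⊎_)
open import Relation.Binary.PropositionalEquality using (_≡_; _≢_)

-- Sierpiński graph S_p^n: vertices are words i₁⋯iₙ over {0,…,p-1},
-- i.e. vectors Vec (Fin p) n (position t is  lookup w t).

Word : ℕ → ℕ → Set
Word p n = Vec (Fin p) n

SAdj : (p n : ℕ) → Word p n → Word p n → Set
SAdj p n i j =
  ∃ λ (h : Fin n) →
    (∀ (t : Fin n) → t < h → lookup i t ≡ lookup j t) ×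
    (lookup i h ≢ lookup j h) ×
    (∀ (t : Fin n) → h < t → (lookup i t ≡ lookup j h) × (lookup j t ≡ lookup i h))

module _ {V : Set} (Adj : V → V → Set) where

  -- Walk u v xs : the vertex list xs is a u,v-walk (consecutive vertices adjacent).
  -- Its length (number of edges) is  length xs - 1.
  data Walk (u v : V) : List V → Set where
    single : u ≡ v → Walk u v (u ∷ [])
    step   : ∀ {w xs} → Adj u w → Walk w v xs → Walk u v (u ∷ xs)

  -- A shortest u,v-path: a u,v-walk of minimum length (such walks are paths).
  ShortestPath : V → V → List V → Set
  ShortestPath u v xs = Walk u v xs × (∀ ys → Walk u v ys → length xs ≤ length ys)

  -- Vertex sets X ⊆ V are represented by duplicate-free lists; |X| = length X.

  Avoids : List V → V → V → List V → Set
  Avoids X u v P = ∀ w → w ∈ P → w ∈ X → (w ≡ u ⊎ w ≡ v)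

  Visible : List V → V → V → Set
  Visible X u v = ∃ λ P → ShortestPath u v P × Avoids X u v P

  Positionable : List V → V → V → Set
  Positionable X u v = ∀ P → ShortestPath u v P → Avoids X u v P

  TotalMV : List V → Set
  TotalMV X = ∀ u v → Visible X u v

  OuterMV : List V → Set
  OuterMV X = (∀ u v → u ∈ X → v ∈ X → Visible X u v)
            × (∀ u v → u ∈ X → v ∉ X → Visible X u v)

  TotalGP : List V → Set
  TotalGP X = ∀ u v → Positionable X u v

  OuterGP : List V → Set
  OuterGP X = (∀ u v → u ∈ X → v ∈ X → Positionable X u v)
            × (∀ u v → u ∈ X → v ∉ X → Positionable X u v)

data Property : Set where
  μt μo gpt gpo : Property

Has : {V : Set} (Adj : V → V → Set) → Property → List V → Set
Has Adj μt  X = TotalMV Adj X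
Has Adj μo  X = OuterMV Adj X
Has Adj gpt X = TotalGP Adj X
Has Adj gpo X = OuterGP Adj X

IsSet : {V : Set} (Adj : V → V → Set) → Property → List V → Set
IsSet Adj τ X = Unique X × Has Adj τ X

-- The extreme vertices ⟨c,c⟩ of S_p^2 are simplicial (their neighbours form a clique), so no
-- shortest path passes through one of them internally: they form a total general position set,
-- which has each of the four properties. Conversely each property implies outer mutual
-- visibility. In an outer mutual-visibility set Y, a non-extreme vertex ⟨i,j⟩ is interior to
-- every shortest path from ⟨i,k⟩ to ⟨j,i⟩ and from ⟨j,b⟩ to ⟨i,i⟩. The first fact leaves at most
-- one vertex of Y in each copy, so |Y| ≤ p; when |Y| = p every copy is occupied, and the
-- second fact then excludes non-extreme vertices, so Y is the set of extreme vertices.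
module Submission where

open import Defs
open import Data.Nat using (ℕ; suc; _+_; _≤_; _<_; z≤n; s≤s)
open import Data.Nat.Properties
  using (≤-refl; ≤-trans; ≤-reflexive; <-irrefl; ≤-<-trans; <-≤-trans; ≮⇒≥; <⇒≱;
         +-suc; +-comm; +-mono-≤; +-monoˡ-≤; n≤1+n)
open import Data.Fin using (Fin; _≟_)
open import Data.Fin.Properties using (pigeonhole)
open import Data.Vec using (_∷_; []; head)
open import Data.Vec.Properties using (≡-dec)
open import Data.List using (List; []; _∷_; length; map; tabulate; lookup)
open import Data.List.Properties using (length-map; length-tabulate)
open import Data.List.Membership.Propositional using (_∈_; _∉_)
open import Data.List.Membership.Propositional.Properties
  using (∈-lookup; ∈-map⁻; ∈-tabulate⁺; ∈-tabulate⁻)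
import Data.List.Membership.DecPropositional as DecMembership
open import Data.List.Relation.Unary.Any using (here; there)
import Data.List.Relation.Unary.All as All
import Data.List.Relation.Unary.All.Properties as All
open import Data.List.Relation.Unary.AllPairs using ([]; _∷_)
open import Data.List.Relation.Unary.Unique.Propositional using (Unique)
import Data.List.Relation.Unary.Unique.Propositional.Properties as Unique
open import Data.Product using (∃; _×_; _,_; proj₁; proj₂)
open import Data.Sum using (_⊎_; inj₁; inj₂)
open import Data.Empty using (⊥-elim)
open import Function.Bundles using (_⇔_; mk⇔)
open import Relation.Nullary using (¬_; yes; no; contradiction)
open import Relation.Binary.Definitions using (DecidableEquality)
open import Relation.Binary.PropositionalEquality
  using (_≡_; _≢_; refl; sym; trans; cong; subst; ≢-sym)

module _ {A : Set} where

  unique-lookup : ∀ {xs : List A} → Unique xs →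
                  ∀ {i j} → i Data.Fin.< j → lookup xs i ≢ lookup xs j
  unique-lookup (x∉xs ∷ _) {Fin.zero} {Fin.suc j} _ = All.lookup x∉xs (∈-lookup j)
  unique-lookup (_ ∷ u) {Fin.suc i} {Fin.suc j} (s≤s i<j) = unique-lookup u i<j

  unique-map⁺ : ∀ {B : Set} {f : A → B} {xs} →
                (∀ {x y} → x ∈ xs → y ∈ xs → f x ≡ f y → x ≡ y) →
                Unique xs → Unique (map f xs)
  unique-map⁺ {xs = []} _ [] = []
  unique-map⁺ {xs = x ∷ xs} inj (x∉xs ∷ u) =
    All.map⁺ (All.tabulate λ y∈xs fx≡fy → All.lookup x∉xs y∈xs (inj (here refl) (there y∈xs) fx≡fy))
    ∷ unique-map⁺ (λ x∈ y∈ → inj (there x∈) (there y∈)) u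

unique⇒length≤ : ∀ {n} {xs : List (Fin n)} → Unique xs → length xs ≤ n
unique⇒length≤ {xs = xs} u = ≮⇒≥ λ n<len →
  let (i , j , i<j , same) = pigeonhole n<len (lookup xs) in unique-lookup u i<j same

unique∧length≡⇒∈ : ∀ {n} {xs : List (Fin n)} → Unique xs → length xs ≡ n → ∀ c → c ∈ xs
unique∧length≡⇒∈ {n} {xs} u len c with c ∈? xs
  where open DecMembership _≟_
... | yes c∈xs = c∈xs
... | no c∉xs =
  contradiction (unique⇒length≤ (All.tabulate (λ { c∈xs refl → c∉xs c∈xs }) ∷ u))
                (λ sn≤n → <-irrefl refl (subst (_< n) len sn≤n))

module _ {V : Set} {Adj : V → V → Set} where

  walk-potential-bound : (h : V → ℕ) → (∀ {x y} → Adj x y → h x ≤ suc (h y)) →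
                         ∀ {u v xs} → Walk Adj u v xs → h u < h v + length xs
  walk-potential-bound h lip {u} (single refl) = ≤-reflexive (+-comm 1 (h u))
  walk-potential-bound h lip {v = v} (step {xs = xs} a wk) =
    <-≤-trans (≤-<-trans (lip a) (s≤s (walk-potential-bound h lip wk)))
              (≤-reflexive (sym (+-suc (h v) (length xs))))

  shortest-by-potential : (h : V → ℕ) → (∀ {x y} → Adj x y → h x ≤ suc (h y)) →
                          ∀ {u v xs} → h v ≡ 0 → Walk Adj u v xs → length xs ≡ suc (h u) →
                          ShortestPath Adj u v xs
  shortest-by-potential h lip {u} hv≡0 wk len = wk , λ ys wk′ →
    subst (_≤ length ys) (sym len)
          (subst (λ k → h u < k + length ys) hv≡0 (walk-potential-bound h lip wk′))

  through-short-walks⇒¬visible : ∀ {X u v z n xs} → z ∈ X → z ≢ u → z ≢ v →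
    Walk Adj u v xs → length xs ≤ n → (∀ {ys} → Walk Adj u v ys → length ys ≤ n → z ∈ ys) →
    ¬ Visible Adj X u v
  through-short-walks⇒¬visible {z = z} z∈X z≢u z≢v wk len through (P , (wkP , minimal) , avoids)
    with avoids z (through wkP (≤-trans (minimal _ wk) len)) z∈X
  ... | inj₁ z≡u = z≢u z≡u
  ... | inj₂ z≡v = z≢v z≡v

  outerMV⇒visible : DecidableEquality V → ∀ {X u} → OuterMV Adj X → u ∈ X → ∀ v → Visible Adj X u v
  outerMV⇒visible _≟V_ {X} (inside , outside) u∈X v with v ∈? X
    where open DecMembership _≟V_
  ... | yes v∈X = inside _ v u∈X v∈X
  ... | no v∉X = outside _ v u∈X v∉X

  module _ (shortest : ∀ u v → ∃ (ShortestPath Adj u v)) where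

    positionable⇒visible : ∀ {X u v} → Positionable Adj X u v → Visible Adj X u v
    positionable⇒visible {u = u} {v} pos = let (P , sp) = shortest u v in P , sp , pos P sp

    totalGP⇒has : ∀ {X} → TotalGP Adj X → ∀ τ → Has Adj τ X
    totalGP⇒has gp μt  u v = positionable⇒visible (gp u v)
    totalGP⇒has gp μo  = (λ u v _ _ → positionable⇒visible (gp u v)) , (λ u v _ _ → positionable⇒visible (gp u v))
    totalGP⇒has gp gpt = gp
    totalGP⇒has gp gpo = (λ u v _ _ → gp u v) , (λ u v _ _ → gp u v)

    has⇒outerMV : ∀ {X} τ → Has Adj τ X → OuterMV Adj X
    has⇒outerMV μt  mv = (λ u v _ _ → mv u v) , (λ u v _ _ → mv u v)
    has⇒outerMV μo  mv = mv
    has⇒outerMV gpt gp = (λ u v _ _ → positionable⇒visible (gp u v)) , (λ u v _ _ → positionable⇒visible (gp u v))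
    has⇒outerMV gpo (gp , gp′) = (λ u v u∈ v∈ → positionable⇒visible (gp u v u∈ v∈))
                               , (λ u v u∈ v∉ → positionable⇒visible (gp′ u v u∈ v∉))

Simplicial : {V : Set} → (V → V → Set) → V → Set
Simplicial Adj z = ∀ {x y} → Adj x z → Adj z y → x ≡ y ⊎ Adj x y

module _ {V : Set} {Adj : V → V → Set} {z : V} (simplicial : Simplicial Adj z) where

  private
    skip : ∀ {u w v xs} → Adj u w → Walk Adj w v xs → z ∈ xs → z ≢ v →
           ∃ λ ys → Walk Adj u v ys × length ys < suc (length xs)
    skip a (single refl) (here refl) z≢v = ⊥-elim (z≢v refl)
    skip a (step a′ wk) (here refl) _ with simplicial a a′
    ... | inj₁ refl = _ , wk , n≤1+n _
    ... | inj₂ a″ = _ , step a″ wk , ≤-refl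
    skip a (step a′ wk) (there z∈) z≢v = let (ys , wk′ , shorter) = skip a′ wk z∈ z≢v in
                                         _ , step a wk′ , s≤s shorter

  bypass-simplicial : ∀ {u v xs} → Walk Adj u v xs → z ∈ xs → z ≢ u → z ≢ v →
                      ∃ λ ys → Walk Adj u v ys × length ys < length xs
  bypass-simplicial (single _) (here z≡u) z≢u _ = ⊥-elim (z≢u z≡u)
  bypass-simplicial (step _ _) (here z≡u) z≢u _ = ⊥-elim (z≢u z≡u)
  bypass-simplicial (step a wk) (there z∈) _ z≢v = skip a wk z∈ z≢v

  simplicial-on-shortest⇒end : DecidableEquality V → ∀ {u v P} → ShortestPath Adj u v P →
                               z ∈ P → z ≡ u ⊎ z ≡ v
  simplicial-on-shortest⇒end _≟V_ {u} {v} (wk , minimal) z∈P with z ≟V u | z ≟V v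
  ... | yes z≡u | _ = inj₁ z≡u
  ... | no _ | yes z≡v = inj₂ z≡v
  ... | no z≢u | no z≢v = let (ys , wk′ , shorter) = bypass-simplicial wk z∈P z≢u z≢v in
                          contradiction (minimal ys wk′) (<⇒≱ shorter)

pattern ⟨_,_⟩ a b = a ∷ b ∷ []

module S² {p : ℕ} where

  W : Set
  W = Word p 2

  Adj : W → W → Set
  Adj = SAdj p 2

  _≟W_ : DecidableEquality W
  _≟W_ = ≡-dec _≟_

  ⟨,⟩-injective : ∀ {a b c d : Fin p} → _≡_ {A = W} ⟨ a , b ⟩ ⟨ c , d ⟩ → a ≡ c × b ≡ d
  ⟨,⟩-injective refl = refl , refl

  adj-cases : ∀ {a b c d} → Adj ⟨ a , b ⟩ ⟨ c , d ⟩ → (a ≡ c × b ≢ d) ⊎ (a ≢ c × b ≡ c × d ≡ a)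
  adj-cases (Fin.zero , _ , a≢c , later) = inj₂ (a≢c , later (Fin.suc Fin.zero) (s≤s z≤n))
  adj-cases (Fin.suc Fin.zero , earlier , b≢d , _) = inj₁ (earlier Fin.zero (s≤s z≤n) , b≢d)

  adj-within : ∀ {a b d} → b ≢ d → Adj ⟨ a , b ⟩ ⟨ a , d ⟩
  adj-within b≢d = Fin.suc Fin.zero
                 , (λ { Fin.zero _ → refl ; (Fin.suc Fin.zero) (s≤s ()) })
                 , b≢d
                 , (λ { Fin.zero () ; (Fin.suc Fin.zero) (s≤s ()) })

  adj-bridge : ∀ {a b} → a ≢ b → Adj ⟨ a , b ⟩ ⟨ b , a ⟩
  adj-bridge a≢b = Fin.zero
                 , (λ { Fin.zero () ; (Fin.suc Fin.zero) () })
                 , a≢b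
                 , (λ { Fin.zero () ; (Fin.suc Fin.zero) _ → refl , refl })

  into-extreme : ∀ {a b c} → Adj ⟨ a , b ⟩ ⟨ c , c ⟩ → a ≡ c
  into-extreme adj with adj-cases adj
  ... | inj₁ (a≡c , _) = a≡c
  ... | inj₂ (a≢c , _ , c≡a) = ⊥-elim (a≢c (sym c≡a))

  out-of-extreme : ∀ {a b c} → Adj ⟨ c , c ⟩ ⟨ a , b ⟩ → c ≡ a
  out-of-extreme adj with adj-cases adj
  ... | inj₁ (c≡a , _) = c≡a
  ... | inj₂ (c≢a , c≡a , _) = ⊥-elim (c≢a c≡a)

  bridge-into : ∀ {i j b y} → j ≢ i → Adj ⟨ j , b ⟩ ⟨ i , y ⟩ → y ≡ j
  bridge-into j≢i adj with adj-cases adj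
  ... | inj₁ (j≡i , _) = ⊥-elim (j≢i j≡i)
  ... | inj₂ (_ , _ , y≡j) = y≡j

  common-neighbour : ∀ {i j k w} → i ≢ j → Adj ⟨ i , k ⟩ w → Adj w ⟨ j , i ⟩ → w ≡ ⟨ i , j ⟩
  common-neighbour {w = ⟨ x , y ⟩} i≢j ik∼w w∼ji with adj-cases ik∼w | adj-cases w∼ji
  ... | inj₁ (refl , _) | inj₁ (refl , _) = ⊥-elim (i≢j refl)
  ... | inj₁ (refl , _) | inj₂ (_ , refl , _) = refl
  ... | inj₂ (_ , _ , refl) | inj₁ (_ , y≢i) = ⊥-elim (y≢i refl)
  ... | inj₂ (_ , _ , refl) | inj₂ (_ , refl , _) = ⊥-elim (i≢j refl)

  δ : Fin p → Fin p → ℕ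
  δ a b with a ≟ b
  ... | yes _ = 0
  ... | no _ = 1

  δ≤1 : ∀ a b → δ a b ≤ 1
  δ≤1 a b with a ≟ b
  ... | yes _ = z≤n
  ... | no _ = ≤-refl

  δ-refl : ∀ a → δ a a ≡ 0
  δ-refl a with a ≟ a
  ... | yes _ = refl
  ... | no a≢a = contradiction refl a≢a

  δ-≢ : ∀ {a b} → a ≢ b → δ a b ≡ 1
  δ-≢ {a} {b} a≢b with a ≟ b
  ... | yes a≡b = contradiction a≡b a≢b
  ... | no _ = refl

  -- The distance in S_p^2: a path between different copies a and c must cross the bridge ⟨a,c⟩ ⟨c,a⟩.
  dist : W → W → ℕ
  dist ⟨ a , b ⟩ ⟨ c , d ⟩ with a ≟ c
  ... | yes _ = δ b d
  ... | no _ = suc (δ b c + δ a d)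

  dist-refl : ∀ v → dist v v ≡ 0
  dist-refl ⟨ a , b ⟩ with a ≟ a
  ... | yes _ = δ-refl b
  ... | no a≢a = contradiction refl a≢a

  dist-lipschitz : ∀ t {x y} → Adj x y → dist x t ≤ suc (dist y t)
  dist-lipschitz ⟨ c , d ⟩ {⟨ a , b ⟩} {⟨ _ , _ ⟩} adj with adj-cases adj
  ... | inj₁ (refl , _) with a ≟ c
  ...   | yes _ = ≤-trans (δ≤1 b d) (s≤s z≤n)
  ...   | no _ = s≤s (+-monoˡ-≤ (δ a d) (≤-trans (δ≤1 b c) (s≤s z≤n)))
  dist-lipschitz ⟨ c , d ⟩ {⟨ a , b ⟩} {⟨ _ , _ ⟩} adj | inj₂ (_ , refl , refl) with a ≟ c | b ≟ c
  ...   | yes _ | _ = ≤-trans (δ≤1 b d) (s≤s z≤n)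
  ...   | no _ | yes refl = s≤s (≤-reflexive (cong (_+ δ a d) (δ-refl b)))
  ...   | no a≢c | no _ rewrite δ-≢ a≢c = s≤s (+-mono-≤ (δ≤1 b c) (≤-trans (δ≤1 a d) (s≤s z≤n)))

  within-walk : ∀ a b d → ∃ λ xs → Walk Adj ⟨ a , b ⟩ ⟨ a , d ⟩ xs × length xs ≡ suc (δ b d)
  within-walk a b d with b ≟ d
  ... | yes refl = _ , single refl , refl
  ... | no b≢d = _ , step (adj-within b≢d) (single refl) , refl

  dist-walk : ∀ u v → ∃ λ xs → Walk Adj u v xs × length xs ≡ suc (dist u v)
  dist-walk ⟨ a , b ⟩ ⟨ c , d ⟩ with a ≟ c
  ... | yes refl = within-walk a b d
  ... | no a≢c with within-walk c a d
  ...   | xs , wk , len with b ≟ c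
  ...     | yes refl = _ , step {w = ⟨ c , a ⟩} (adj-bridge a≢c) wk , cong suc len
  ...     | no b≢c = _ , step {w = ⟨ a , c ⟩} (adj-within b≢c) (step {w = ⟨ c , a ⟩} (adj-bridge a≢c) wk) , cong (λ k → suc (suc k)) len

  shortest-path : ∀ u v → ∃ (ShortestPath Adj u v)
  shortest-path u v =
    let (xs , wk , len) = dist-walk u v in
    xs , shortest-by-potential (λ x → dist x v) (λ {x} {y} → dist-lipschitz v {x} {y}) (dist-refl v) wk len

  extremes : List W
  extremes = tabulate λ c → ⟨ c , c ⟩

  extremes-unique : Unique extremes
  extremes-unique = Unique.tabulate⁺ (λ e → proj₁ (⟨,⟩-injective e))

  length-extremes : length extremes ≡ p
  length-extremes = length-tabulate _

  extreme-simplicial : ∀ c → Simplicial Adj ⟨ c , c ⟩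
  extreme-simplicial c {⟨ a , b ⟩} {⟨ a′ , b′ ⟩} x∼cc cc∼y
    with into-extreme x∼cc | out-of-extreme cc∼y
  ... | refl | refl with b ≟ b′
  ...   | yes refl = inj₁ refl
  ...   | no b≢b′ = inj₂ (adj-within b≢b′)

  extremes-totalGP : TotalGP Adj extremes
  extremes-totalGP u v P sp w w∈P w∈extremes with ∈-tabulate⁻ w∈extremes
  ... | c , refl = simplicial-on-shortest⇒end (extreme-simplicial c) _≟W_ sp w∈P

  ij-cuts-ik-ji : ∀ {i j k xs} → i ≢ j → k ≢ j → Walk Adj ⟨ i , k ⟩ ⟨ j , i ⟩ xs → length xs ≤ 3 →
                  ⟨ i , j ⟩ ∈ xs
  ij-cuts-ik-ji i≢j _ (single ik≡ji) _ = ⊥-elim (i≢j (proj₁ (⟨,⟩-injective ik≡ji)))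
  ij-cuts-ik-ji i≢j k≢j (step ik∼ji (single refl)) _ with adj-cases ik∼ji
  ... | inj₁ (i≡j , _) = ⊥-elim (i≢j i≡j)
  ... | inj₂ (_ , k≡j , _) = ⊥-elim (k≢j k≡j)
  ij-cuts-ik-ji i≢j _ (step ik∼w (step w∼ji (single refl))) _ =
    there (here (sym (common-neighbour i≢j ik∼w w∼ji)))
  ij-cuts-ik-ji _ _ (step _ (step _ (step _ (single _)))) (s≤s (s≤s (s≤s ())))
  ij-cuts-ik-ji _ _ (step _ (step _ (step _ (step _ _)))) (s≤s (s≤s (s≤s ())))

  ij-cuts-jb-ii : ∀ {i j b xs} → i ≢ j → Walk Adj ⟨ j , b ⟩ ⟨ i , i ⟩ xs → length xs ≤ 4 →
                  ⟨ i , j ⟩ ∈ xs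
  ij-cuts-jb-ii i≢j (single jb≡ii) _ = ⊥-elim (i≢j (sym (proj₁ (⟨,⟩-injective jb≡ii))))
  ij-cuts-jb-ii i≢j (step jb∼ii (single refl)) _ = ⊥-elim (i≢j (sym (into-extreme jb∼ii)))
  ij-cuts-jb-ii i≢j (step {w = ⟨ _ , _ ⟩} jb∼w (step w∼ii (single refl))) _
    with into-extreme w∼ii
  ... | refl with bridge-into (≢-sym i≢j) jb∼w
  ...   | refl = there (here refl)
  ij-cuts-jb-ii i≢j (step {w = ⟨ _ , _ ⟩} jb∼w₁ (step {w = ⟨ _ , _ ⟩} w₁∼w₂ (step w₂∼ii (single refl)))) _
    with into-extreme w₂∼ii
  ... | refl with adj-cases w₁∼w₂
  ...   | inj₁ (refl , _) with bridge-into (≢-sym i≢j) jb∼w₁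
  ...     | refl = there (here refl)
  ij-cuts-jb-ii i≢j (step {w = ⟨ _ , _ ⟩} jb∼w₁ (step {w = ⟨ _ , _ ⟩} w₁∼w₂ (step w₂∼ii (single refl)))) _
    | refl | inj₂ (_ , refl , refl) with adj-cases jb∼w₁
  ...     | inj₁ (refl , _) = there (there (here refl))
  ...     | inj₂ (_ , _ , i≡j) = ⊥-elim (i≢j i≡j)
  ij-cuts-jb-ii _ (step _ (step _ (step _ (step _ (single _))))) (s≤s (s≤s (s≤s (s≤s ()))))
  ij-cuts-jb-ii _ (step _ (step _ (step _ (step _ (step _ _))))) (s≤s (s≤s (s≤s (s≤s ()))))

  module _ {Y : List W} (outer : OuterMV Adj Y) where

    outerMV-nonextreme-alone : ∀ {i j k} → ⟨ i , j ⟩ ∈ Y → i ≢ j → k ≢ j → ⟨ i , k ⟩ ∉ Y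
    outerMV-nonextreme-alone {i} {j} {k} ij∈Y i≢j k≢j ik∈Y =
      through-short-walks⇒¬visible ij∈Y
        (λ ij≡ik → k≢j (sym (proj₂ (⟨,⟩-injective ij≡ik))))
        (λ ij≡ji → i≢j (proj₁ (⟨,⟩-injective ij≡ji)))
        (step {w = ⟨ i , j ⟩} (adj-within k≢j) (step (adj-bridge i≢j) (single refl))) ≤-refl
        (ij-cuts-ik-ji i≢j k≢j)
        (outerMV⇒visible _≟W_ outer ik∈Y ⟨ j , i ⟩)

    outerMV-nonextreme-blocks : ∀ {i j b} → ⟨ i , j ⟩ ∈ Y → i ≢ j → ⟨ j , b ⟩ ∉ Y
    outerMV-nonextreme-blocks {i} {j} {b} ij∈Y i≢j jb∈Y =
      through-short-walks⇒¬visible ij∈Y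
        (λ ij≡jb → i≢j (proj₁ (⟨,⟩-injective ij≡jb)))
        (λ ij≡ii → i≢j (sym (proj₂ (⟨,⟩-injective ij≡ii))))
        (proj₁ (proj₂ walk)) (proj₂ (proj₂ walk))
        (ij-cuts-jb-ii i≢j)
        (outerMV⇒visible _≟W_ outer jb∈Y ⟨ i , i ⟩)
      where
      walk : ∃ λ xs → Walk Adj ⟨ j , b ⟩ ⟨ i , i ⟩ xs × length xs ≤ 4
      walk with b ≟ i
      ... | yes refl = _ , step {w = ⟨ i , j ⟩} (adj-bridge (≢-sym i≢j))
                             (step (adj-within (≢-sym i≢j)) (single refl)) , n≤1+n 3
      ... | no b≢i = _ , step {w = ⟨ j , i ⟩} (adj-within b≢i) (step {w = ⟨ i , j ⟩} (adj-bridge (≢-sym i≢j))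
                             (step (adj-within (≢-sym i≢j)) (single refl))) , ≤-refl

    outerMV-one-per-copy : ∀ {i a b} → ⟨ i , a ⟩ ∈ Y → ⟨ i , b ⟩ ∈ Y → a ≡ b
    outerMV-one-per-copy {i} {a} {b} ia∈Y ib∈Y with a ≟ b | a ≟ i
    ... | yes a≡b | _ = a≡b
    ... | no a≢b | no a≢i = contradiction ib∈Y (outerMV-nonextreme-alone ia∈Y (≢-sym a≢i) (≢-sym a≢b))
    ... | no a≢b | yes refl = contradiction ia∈Y (outerMV-nonextreme-alone ib∈Y a≢b a≢b)

    outerMV-copy-injective : ∀ {x y} → x ∈ Y → y ∈ Y → head x ≡ head y → x ≡ y
    outerMV-copy-injective {⟨ a , _ ⟩} {⟨ _ , _ ⟩} x∈Y y∈Y refl =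
      cong (λ d → ⟨ a , d ⟩) (outerMV-one-per-copy x∈Y y∈Y)

    copies-unique : Unique Y → Unique (map head Y)
    copies-unique = unique-map⁺ outerMV-copy-injective

    outerMV⇒length≤ : Unique Y → length Y ≤ p
    outerMV⇒length≤ uniq = subst (_≤ p) (length-map head Y) (unique⇒length≤ (copies-unique uniq))

    module _ (uniq : Unique Y) (full : length Y ≡ p) where

      every-copy-occupied : ∀ c → ∃ λ b → ⟨ c , b ⟩ ∈ Y
      every-copy-occupied c
        with ∈-map⁻ head (unique∧length≡⇒∈ (copies-unique uniq) (trans (length-map head Y) full) c)
      ... | ⟨ _ , b ⟩ , cb∈Y , refl = b , cb∈Y

      occupied⇒extreme : ∀ {i j} → ⟨ i , j ⟩ ∈ Y → i ≡ j
      occupied⇒extreme {i} {j} ij∈Y with i ≟ j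
      ... | yes i≡j = i≡j
      ... | no i≢j = let (_ , jb∈Y) = every-copy-occupied j in
                     contradiction jb∈Y (outerMV-nonextreme-blocks ij∈Y i≢j)

      full⇒extremes : ∀ v → v ∈ Y ⇔ v ∈ extremes
      full⇒extremes _ = mk⇔ to from
        where
        to : ∀ {v} → v ∈ Y → v ∈ extremes
        to {⟨ c , _ ⟩} v∈Y with occupied⇒extreme v∈Y
        ... | refl = ∈-tabulate⁺ c
        from : ∀ {v} → v ∈ extremes → v ∈ Y
        from v∈extremes with ∈-tabulate⁻ v∈extremes
        ... | c , refl with every-copy-occupied c
        ...   | b , cb∈Y with occupied⇒extreme cb∈Y
        ...     | refl = cb∈Y

open S²

theorem3p5 : ∀ (p : ℕ) → 3 ≤ p → ∀ (τ : Property) →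
    ∃ λ (X : List (Word p 2)) →
      IsSet (SAdj p 2) τ X × length X ≡ p ×
      (∀ (Y : List (Word p 2)) → IsSet (SAdj p 2) τ Y → length Y ≤ p) ×
      (∀ (Y : List (Word p 2)) → IsSet (SAdj p 2) τ Y → length Y ≡ p →
         ∀ v → (v ∈ Y ⇔ v ∈ X))
theorem3p5 p _ τ =
  extremes , (extremes-unique , totalGP⇒has shortest-path extremes-totalGP τ) , length-extremes ,
  (λ Y (uniq , has) → outerMV⇒length≤ (outer Y has) uniq) ,
  (λ Y (uniq , has) full → full⇒extremes (outer Y has) uniq full)
  where
  outer : ∀ Y → Has (SAdj p 2) τ Y → OuterMV (SAdj p 2) Y
  outer _ = has⇒outerMV shortest-path τ
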